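{- Let $\Sigma$ be a compact (possibly nonorientable) surface and $G$ a graph cellularly embedded in $\Sigma$, with Poincaré dual $G^*$. Let $\Delta = 2c(\Sigma) - \chi(\Sigma)$. Then \[ LV_{G,\Sigma}(X,Y,Z) = Z^{\Delta/2}\, P_{G,\Sigma}(X-1,Y-1,Z^{ -1},Z). \]
   Context: $G$ is cellularly embedded if $\Sigma\setminus G$ is a disjoint union of open discs; the Poincaré dual $G^*$ has a vertex in each face of $G$ and an edge $e^*$ crossing each edge $e$ of $G$, joining the faces on either side; edges of $G$ and $G^*$ are identified via $e\leftrightarrow e^*$. $c(\cdot)$ counts connected components, $\chi$ is Euler characteristic; for $F\subseteq E(G)$, $c(F)$ is the number of components of the spanning subgraph of $G$ with edge set $F$. For a spanning subgraph $F$ of $G$, let $\mathcal{F}$ be a regular neighborhood of $F$ in $\Sigma$; $\mathcal{S}(F)$ is obtained by gluing discs to the boundary components of $\mathcal{F}$, and $\mathcal{S}^\perp(F)$ by gluing discs to the boundary components of the closure of $\Sigma\setminus\mathcal{F}$; $s(F) = 2c(F) - \chi(\mathcal{S}(F))$, $s^\perp(F) = 2c(\Sigma\setminus F) - \chi(\mathcal{S}^\perp(F))$. The generalized Krushkal polynomial is $P_{G,\Sigma}(X,Y,A,B) = \sum_{F\subseteq G} X^{c(F)-c(G)} Y^{c(\Sigma\setminus F)-c(\Sigma)} A^{s(F)/2} B^{s^\perp(F)/2}$. Let $r(F) = v(G) - c(F)$ be the rank function of the cycle matroid of $G$ on $E(G)$. Let $r_{G^*}(F) = v(G^*) - c_{G^*}(F)$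 be the cycle-matroid rank of $G^*$ and $\bar r(F) = |F| + r_{G^*}(E(G)\setminus F) - r_{G^*}(E(G))$ the rank function of the bond matroid of $G^*$ (edges identified with those of $G$), with nullity $\bar n(F) = |F| - \bar r(F)$. The Las Vergnas polynomial is \[ LV_{G,\Sigma}(X,Y,Z) = \sum_{F\subseteq E(G)} (X-1)^{r(E(G))-r(F)} (Y-1)^{\bar n(F)} Z^{(\bar r(E(G))-\bar r(F)) - (r(E(G)) - r(F))}. \] -}

module Defs where

open import Level using (Level)
open import Data.Bool using (Bool; true; false; not; _∧_; _∨_; if_then_else_)
open import Data.Nat as ℕ using (ℕ; zero; suc; _∸_; _<ᵇ_)
open import Data.Fin using (Fin; toℕ)
open import Data.Fin.Subset using (Subset; ⁅_⁆; ∁; ∣_∣)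
open import Data.Vec using (Vec; []; _∷_; lookup; tabulate)
open import Data.List using (List; []; _∷_; [_]; map; _++_; allFin; foldr)
open import Data.Bool.ListAction using (any)
open import Data.Nat.ListAction using (sum)
open import Data.Integer as ℤ using (ℤ; +_; -[1+_])
open import Data.Product using (Σ; _,_)
open import Data.Sum using (_⊎_)
open import Relation.Binary.PropositionalEquality using (_≡_; _≢_; sym)
open import Algebra.Bundles using (CommutativeRing)

iterate : {A : Set} → ℕ → (A → A) → A → A
iterate zero    f a = a
iterate (suc k) f a = iterate k f (f a)

closeStep : ∀ {n} → List (Fin n → Fin n) → Subset n → Subset n
closeStep gs S = tabulate (λ j → lookup S j ∨ any (λ g → lookup S (g j)) gs)

-- the orbit of i (n steps suffice on n points)
orbit : ∀ {n} → List (Fin n → Fin n) → Fin n → Subset n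
orbit {n} gs i = iterate n (closeStep gs) ⁅ i ⁆

isRep : ∀ {n} → List (Fin n → Fin n) → Fin n → Bool
isRep {n} gs i = not (any (λ j → (toℕ j <ᵇ toℕ i) ∧ lookup (orbit gs i) j) (allFin n))

orbits : ∀ {n} → List (Fin n → Fin n) → ℕ
orbits {n} gs = sum (map (λ i → if isRep gs i then 1 else 0) (allFin n))

-- Cellularly embedded graphs in closed (possibly nonorientable,
-- possibly disconnected) surfaces, encoded as graph-encoded maps
-- (gems / flag systems), plus `iso` isolated vertices each forming a
-- sphere component (these have no flags).  Vertices = <t1,t2>-orbits,
-- edges = <t0,t2>-orbits (labelled by ed into Fin m),
-- faces = <t0,t1>-orbits, surface components = <t0,t1,t2>-orbits.

record Gem : Set where
  field
    n      : ℕ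
    m      : ℕ
    iso    : ℕ
    t0 t1 t2 : Fin n → Fin n
    t0-inv : ∀ x → t0 (t0 x) ≡ x
    t1-inv : ∀ x → t1 (t1 x) ≡ x
    t2-inv : ∀ x → t2 (t2 x) ≡ x
    t0-fpf : ∀ x → t0 x ≢ x
    t1-fpf : ∀ x → t1 x ≢ x
    t2-fpf : ∀ x → t2 x ≢ x
    t02-comm : ∀ x → t0 (t2 x) ≡ t2 (t0 x)
    t02-fpf  : ∀ x → t0 (t2 x) ≢ x
    ed     : Fin n → Fin m
    ed-t0  : ∀ x → ed (t0 x) ≡ ed x
    ed-t2  : ∀ x → ed (t2 x) ≡ ed x
    ed-fib : ∀ x y → ed x ≡ ed y →
             y ≡ x ⊎ y ≡ t0 x ⊎ y ≡ t2 x ⊎ y ≡ t0 (t2 x)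
    ed-surj : ∀ e → Σ (Fin n) (λ x → ed x ≡ e)

dual : Gem → Gem
dual G = record
  { n = n ; m = m ; iso = iso ; t0 = t2 ; t1 = t1 ; t2 = t0
  ; t0-inv = t2-inv ; t1-inv = t1-inv ; t2-inv = t0-inv
  ; t0-fpf = t2-fpf ; t1-fpf = t1-fpf ; t2-fpf = t0-fpf
  ; t02-comm = λ x → sym (t02-comm x)
  ; t02-fpf = λ x eq → t02-fpf x (Relation.Binary.PropositionalEquality.trans (t02-comm x) eq)
  ; ed = ed ; ed-t0 = ed-t2 ; ed-t2 = ed-t0
  ; ed-fib = λ x y eq → fib x y eq
  ; ed-surj = ed-surj }
  where
  open Gem G
  open import Data.Sum using (inj₁; inj₂)
  open import Relation.Binary.PropositionalEquality using (trans)
  fib : ∀ x y → ed x ≡ ed y → y ≡ x ⊎ y ≡ t2 x ⊎ y ≡ t0 x ⊎ y ≡ t2 (t0 x)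
  fib x y eq with ed-fib x y eq
  ... | inj₁ p = inj₁ p
  ... | inj₂ (inj₁ p) = inj₂ (inj₂ (inj₁ p))
  ... | inj₂ (inj₂ (inj₁ p)) = inj₂ (inj₁ p)
  ... | inj₂ (inj₂ (inj₂ p)) = inj₂ (inj₂ (inj₂ (trans p (t02-comm x))))

-- spanning subgraphs are subsets of the edge set Fin m
EdgeSet : Gem → Set
EdgeSet G = Subset (Gem.m G)

allE : (G : Gem) → EdgeSet G
allE G = tabulate (λ _ → true)

module _ (G : Gem) where
  open Gem G

  inF : EdgeSet G → Fin n → Bool
  inF F x = lookup F (ed x)

  t0F : EdgeSet G → Fin n → Fin n
  t0F F x = if inF F x then t0 x else x

  -- boundary involution of the ribbon subgraph (V, F)
  ρ : EdgeSet G → Fin n → Fin n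
  ρ F x = if inF F x then t0 x else t2 x

  v : ℕ
  v = orbits (t1 ∷ t2 ∷ []) ℕ.+ iso

  faces : ℕ
  faces = orbits (t0 ∷ t1 ∷ []) ℕ.+ iso

  cSurf : ℕ
  cSurf = orbits (t0 ∷ t1 ∷ t2 ∷ []) ℕ.+ iso

  χSurf : ℤ
  χSurf = (+ v ℤ.- + m) ℤ.+ + faces

  Δ : ℤ
  Δ = + (2 ℕ.* cSurf) ℤ.- χSurf

  cc : EdgeSet G → ℕ
  cc F = orbits (t1 ∷ t2 ∷ t0F F ∷ []) ℕ.+ iso

  bdry : EdgeSet G → ℕ
  bdry F = orbits (t1 ∷ ρ F ∷ []) ℕ.+ iso

  χS : EdgeSet G → ℤ
  χS F = (+ v ℤ.- + ∣ F ∣) ℤ.+ + bdry F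

  s : EdgeSet G → ℤ
  s F = + (2 ℕ.* cc F) ℤ.- χS F

  rk : EdgeSet G → ℕ
  rk F = v ∸ cc F

-- complement side, via the dual map: Σ \ F deformation retracts onto the
-- dual ribbon subgraph with edges E \ F, and S^⊥(F) = S_{G*}(E \ F)
cCompl : (G : Gem) → EdgeSet G → ℕ
cCompl G F = cc (dual G) (∁ F)

sPerp : (G : Gem) → EdgeSet G → ℤ
sPerp G F = s (dual G) (∁ F)

rkDual : (G : Gem) → EdgeSet G → ℕ
rkDual G F = rk (dual G) F

rkBar : (G : Gem) → EdgeSet G → ℕ
rkBar G F = (∣ F ∣ ℕ.+ rkDual G (∁ F)) ∸ rkDual G (allE G)

nBar : (G : Gem) → EdgeSet G → ℕ
nBar G F = ∣ F ∣ ∸ rkBar G F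

allSubsets : (k : ℕ) → List (Subset k)
allSubsets zero    = [ [] ]
allSubsets (suc k) = map (true ∷_) (allSubsets k) ++ map (false ∷_) (allSubsets k)

module Eval {c ℓ : Level} (R : CommutativeRing c ℓ) where
  open CommutativeRing R

  pow : Carrier → ℕ → Carrier
  pow a zero    = 1#
  pow a (suc k) = a * pow a k

  zpow : Carrier → Carrier → ℤ → Carrier
  zpow u uinv (+ k)    = pow u k
  zpow u uinv -[1+ k ] = pow uinv (suc k)

  ΣF : (G : Gem) → (EdgeSet G → Carrier) → Carrier
  ΣF G f = foldr (λ F acc → f F + acc) 0# (allSubsets (Gem.m G))

  LV : (G : Gem) → Carrier → Carrier → Carrier → Carrier → Carrier
  LV G x y z zinv = ΣF G (λ F →
      pow (x - 1#) (rk G (allE G) ∸ rk G F)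
    * pow (y - 1#) (nBar G F)
    * zpow z zinv ((+ (rkBar G (allE G) ∸ rkBar G F)) ℤ.- (+ (rk G (allE G) ∸ rk G F))))

  -- P_{G,Σ}(X, Y, A, B) with A = α², B = β² (so A^{s/2} = α^s, B^{s⊥/2} = β^{s⊥});
  -- α, β invertible with inverses αinv, βinv
  P½ : (G : Gem) → Carrier → Carrier → (α αinv β βinv : Carrier) → Carrier
  P½ G X Y α αinv β βinv = ΣF G (λ F →
      pow X (cc G F ∸ cc G (allE G))
    * pow Y (cCompl G F ∸ cSurf G)
    * zpow α αinv (s G F)
    * zpow β βinv (sPerp G F))

module Submission where

-- Both sides are sums over the spanning subgraphs F, so it suffices to show that the
-- Las Vergnas summand of F is w^Δ times the Krushkal summand of F.

open import Defs
open import Level using (Level)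
open import Algebra.Bundles using (CommutativeRing)

module Subsets where
  open import Data.Bool using (Bool; true; false; not; T; if_then_else_)
  open import Data.Bool.Properties using (T-≡)
  open import Data.Empty using (⊥-elim)
  open import Data.Fin using (Fin; zero; suc)
  open import Data.Fin.Properties using (suc-injective)
  open import Data.Fin.Subset using (Subset; inside; outside; _∈_; _∉_; _⊆_; _∪_; ∁; ∣_∣)
  open import Data.Fin.Subset.Properties using (p⊆q⇒∣p∣≤∣q∣; ∣p∣≤n; ∣∁p∣≡n∸∣p∣; drop-there; x∈p∪q⁺; x∉p⇒x∈∁p; _∈?_)
  open import Data.List as List using (List; []; _∷_; allFin; length)
  open import Data.List.Properties using (map-tabulate; length-map)
  open import Data.List.Membership.Propositional using () renaming (_∈_ to _∈ₗ_)
  open import Data.List.Membership.Propositional.Properties using (∈-map⁺)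
  open import Data.List.Relation.Unary.Any using (here; there)
  open import Data.Nat using (zero; suc; _+_; _≤_; s≤s; z≤n)
  open import Data.Nat.ListAction using (sum)
  open import Data.Nat.Properties using (≤-trans; n≤1+n; m+[n∸m]≡n)
  open import Data.Sum using (inj₁; inj₂)
  open import Data.Vec using ([]; _∷_; lookup; tabulate; here; there)
  open import Data.Vec.Properties using (lookup∘tabulate; []=⇒lookup; lookup⇒[]=)
  open import Function using (_∘_; Equivalence)
  open import Relation.Binary.PropositionalEquality using (_≡_; refl; sym; trans; cong; subst)
  open import Relation.Nullary using (¬_; yes; no)

  open Equivalence using (to; from)

  T-ext : ∀ {a b} → (T a → T b) → (T b → T a) → a ≡ b
  T-ext {false} {false} _   _   = refl
  T-ext {false} {true}  _   b⇒a = ⊥-elim (b⇒a _)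
  T-ext {true}  {false} a⇒b _   = ⊥-elim (a⇒b _)
  T-ext {true}  {true}  _   _   = refl

  T-not : ∀ {b} → T (not b) → ¬ T b
  T-not {true} () _

  ¬T-not : ∀ {b} → ¬ T (not b) → T b
  ¬T-not {true}  _ = _
  ¬T-not {false} h = h _

  ∈⇒T : ∀ {k} {S : Subset k} {x} → x ∈ S → T (lookup S x)
  ∈⇒T x∈S = from T-≡ ([]=⇒lookup x∈S)

  T⇒∈ : ∀ {k} {S : Subset k} {x} → T (lookup S x) → x ∈ S
  T⇒∈ t = lookup⇒[]= _ _ (to T-≡ t)

  ∈-tabulate⁺ : ∀ {k} {f : Fin k → Bool} {x} → T (f x) → x ∈ tabulate f
  ∈-tabulate⁺ {f = f} {x} t = T⇒∈ (subst T (sym (lookup∘tabulate f x)) t)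

  ∈-tabulate⁻ : ∀ {k} {f : Fin k → Bool} {x} → x ∈ tabulate f → T (f x)
  ∈-tabulate⁻ {f = f} {x} x∈ = subst T (lookup∘tabulate f x) (∈⇒T x∈)

  count≡∣tabulate∣ : ∀ {k} (f : Fin k → Bool) →
                     sum (List.map (λ i → if f i then 1 else 0) (allFin k)) ≡ ∣ tabulate f ∣
  count≡∣tabulate∣ f = trans (cong sum (map-tabulate (λ i → i) (λ i → if f i then 1 else 0))) (count f)
    where
    count : ∀ {k} (f : Fin k → Bool) → sum (List.tabulate (λ i → if f i then 1 else 0)) ≡ ∣ tabulate f ∣
    count {zero}  f = refl
    count {suc k} f with f zero
    ... | true  = cong suc (count (f ∘ suc))
    ... | false = count (f ∘ suc)

  ExceptionalUnique : ∀ {k} → Subset k → Subset k → Set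
  ExceptionalUnique p q = ∀ {x y} → x ∈ p → x ∉ q → y ∈ p → y ∉ q → x ≡ y

  tail-unique : ∀ {k b c} {p q : Subset k} → ExceptionalUnique (b ∷ p) (c ∷ q) → ExceptionalUnique p q
  tail-unique uniq x∈ x∉ y∈ y∉ =
    suc-injective (uniq (there x∈) (x∉ ∘ drop-there) (there y∈) (y∉ ∘ drop-there))

  ∣p∣≤1+∣q∣ : ∀ {k} (p q : Subset k) → ExceptionalUnique p q → ∣ p ∣ ≤ suc ∣ q ∣
  ∣p∣≤1+∣q∣ []            []            uniq = z≤n
  ∣p∣≤1+∣q∣ (outside ∷ p) (outside ∷ q) uniq = ∣p∣≤1+∣q∣ p q (tail-unique uniq)
  ∣p∣≤1+∣q∣ (outside ∷ p) (inside  ∷ q) uniq = ≤-trans (∣p∣≤1+∣q∣ p q (tail-unique uniq)) (n≤1+n _)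
  ∣p∣≤1+∣q∣ (inside  ∷ p) (inside  ∷ q) uniq = s≤s (∣p∣≤1+∣q∣ p q (tail-unique uniq))
  ∣p∣≤1+∣q∣ (inside  ∷ p) (outside ∷ q) uniq = s≤s (p⊆q⇒∣p∣≤∣q∣ p⊆q)
    where
    -- zero is the exceptional point, so every other point of p lies in q
    p⊆q : p ⊆ q
    p⊆q {x} x∈p with x ∈? q
    ... | yes x∈q = x∈q
    ... | no  x∉q with uniq here (λ ()) (there x∈p) (x∉q ∘ drop-there)
    ...   | ()

  elements : ∀ {k} → Subset k → List (Fin k)
  elements []            = []
  elements (inside  ∷ p) = zero ∷ List.map suc (elements p)
  elements (outside ∷ p) = List.map suc (elements p)

  ∈-elements : ∀ {k} {p : Subset k} {x} → x ∈ p → x ∈ₗ elements p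
  ∈-elements {p = inside  ∷ p} here        = here refl
  ∈-elements {p = inside  ∷ p} (there x∈p) = there (∈-map⁺ suc (∈-elements x∈p))
  ∈-elements {p = outside ∷ p} (there x∈p) = ∈-map⁺ suc (∈-elements x∈p)

  length-elements : ∀ {k} (p : Subset k) → length (elements p) ≡ ∣ p ∣
  length-elements []            = refl
  length-elements (inside  ∷ p) = cong suc (trans (length-map suc (elements p)) (length-elements p))
  length-elements (outside ∷ p) = trans (length-map suc (elements p)) (length-elements p)

  ∣p∣+∣∁p∣≡n : ∀ {k} (p : Subset k) → ∣ p ∣ + ∣ ∁ p ∣ ≡ k
  ∣p∣+∣∁p∣≡n p = trans (cong (λ t → ∣ p ∣ + t) (∣∁p∣≡n∸∣p∣ p)) (m+[n∸m]≡n (∣p∣≤n p))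

  ⊆-∁∪ : ∀ {k} (p : Subset k) {q} → q ⊆ ∁ p ∪ p
  ⊆-∁∪ p {x = x} _ with x ∈? p
  ... | yes x∈p = x∈p∪q⁺ (inj₂ x∈p)
  ... | no  x∉p = x∈p∪q⁺ (inj₁ (x∉p⇒x∈∁p x∉p))

module Orbits where
  open Subsets
  open import Data.Bool using (T; _∨_; _∧_)
  open import Data.Bool.Properties using (T-∨; T-∧; T?)
  open import Data.Bool.ListAction using (any)
  open import Data.Empty using (⊥; ⊥-elim)
  open import Data.Fin using (Fin; zero; suc; toℕ; _≟_)
  open import Data.Fin.Permutation.Components using (transpose)
  open import Data.Fin.Properties using (any?; toℕ-injective)
  open import Data.Fin.Subset using (Subset; _∈_; _⊆_; _⊂_; ⁅_⁆; ∣_∣)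
  open import Data.Fin.Subset.Properties using (p⊆q⇒∣p∣≤∣q∣; p⊂q⇒∣p∣<∣q∣; ∣p∣≤n; ∣⁅x⁆∣≡1; x∈⁅y⁆⇒x≡y; x∈⁅x⁆)
  open import Data.List using (List; _∷_; allFin)
  open import Data.List.Membership.Propositional using (find; lose) renaming (_∈_ to _∈ₗ_)
  open import Data.List.Membership.Propositional.Properties using (∈-allFin)
  open import Data.List.Relation.Unary.All as All using (All)
  open import Data.List.Relation.Unary.Any using (here; there)
  open import Data.List.Relation.Unary.Any.Properties using (any⁺; any⁻)
  open import Data.Nat using (ℕ; zero; suc; _≤_; _<_; _<ᵇ_; s≤s; z≤n)
  open import Data.Nat.Properties using (≤-trans; <-≤-trans; <-irrefl; <-cmp; ≮⇒≥; <⇒≤; ≤-antisym; <ᵇ⇒<; <⇒<ᵇ)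
  open import Data.Product using (∃; _×_; _,_)
  open import Data.Sum using (_⊎_; inj₁; inj₂)
  open import Data.Vec using (lookup; tabulate)
  open import Data.Vec.Properties using (lookup∘tabulate; tabulate-cong; tabulate∘lookup)
  open import Function using (_∘_; Equivalence)
  open import Relation.Binary using (tri<; tri≈; tri>)
  open import Relation.Binary.PropositionalEquality using (_≡_; _≢_; refl; sym; trans; cong; subst; subst₂)
  open import Relation.Nullary using (¬_; yes; no; _×-dec_; ¬?)

  open Equivalence using (to; from)

  iterate-preserves : ∀ {A : Set} (P : A → Set) {f : A → A} → (∀ {a} → P a → P (f a)) →
                      ∀ k {a} → P a → P (iterate k f a)
  iterate-preserves P pf zero    pa = pa
  iterate-preserves P pf (suc k) pa = iterate-preserves P pf k (pf pa)

  iterate-suc : ∀ {A : Set} k (f : A → A) a → iterate (suc k) f a ≡ f (iterate k f a)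
  iterate-suc zero    f a = refl
  iterate-suc (suc k) f a = iterate-suc k f (f a)

  module _ {n : ℕ} where

    data Reach (gs : List (Fin n → Fin n)) (i : Fin n) : Fin n → Set where
      start : Reach gs i i
      step  : ∀ {j g} → Reach gs i j → g ∈ₗ gs → Reach gs i (g j)

    Involution : (Fin n → Fin n) → Set
    Involution g = ∀ x → g (g x) ≡ x

    Refines : List (Fin n → Fin n) → List (Fin n → Fin n) → Set
    Refines gs hs = All (λ g → ∀ x → Reach hs x (g x)) gs

    move : ∀ {hs g x y} → g ∈ₗ hs → g x ≡ y → Reach hs x y
    move g∈ refl = step start g∈

    reach-trans : ∀ {gs i j k} → Reach gs i j → Reach gs j k → Reach gs i k
    reach-trans p start      = p
    reach-trans p (step q g∈) = step (reach-trans p q) g∈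

    -- for involutions a generator step can be undone, so reachability is symmetric
    reach-sym : ∀ {gs i j} → All Involution gs → Reach gs i j → Reach gs j i
    reach-sym inv start                  = start
    reach-sym inv (step {j = j} p g∈) =
      reach-trans (move g∈ (All.lookup inv g∈ j)) (reach-sym inv p)

    reach-refine : ∀ {gs hs i j} → Refines gs hs → Reach gs i j → Reach hs i j
    reach-refine r start       = start
    reach-refine r (step p g∈) = reach-trans (reach-refine r p) (All.lookup r g∈ _)

    closeStep-lookup : ∀ gs (S : Subset n) j →
                       lookup (closeStep gs S) j ≡ (lookup S j ∨ any (λ g → lookup S (g j)) gs)
    closeStep-lookup gs S j = lookup∘tabulate _ j

    closeStep-adds : ∀ {gs g} (S : Subset n) {j} → g ∈ₗ gs → T (lookup S (g j)) → T (lookup (closeStep gs S) j)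
    closeStep-adds {gs} S {j} g∈ gj∈S =
      subst T (sym (closeStep-lookup gs S j)) (from T-∨ (inj₂ (any⁺ _ (lose g∈ gj∈S))))

    closeStep-inflationary : ∀ {gs} (S : Subset n) {j} → T (lookup S j) → T (lookup (closeStep gs S) j)
    closeStep-inflationary {gs} S {j} j∈S = subst T (sym (closeStep-lookup gs S j)) (from T-∨ (inj₁ j∈S))

    Reached : List (Fin n → Fin n) → Fin n → Subset n → Set
    Reached gs i S = ∀ j → T (lookup S j) → Reach gs i j

    closeStep-reached : ∀ {gs i S} → All Involution gs → Reached gs i S → Reached gs i (closeStep gs S)
    closeStep-reached {gs} {i} {S} inv reached j j∈ with to T-∨ (subst T (closeStep-lookup gs S j) j∈)
    ... | inj₁ j∈S = reached j j∈S
    ... | inj₂ hit with find (any⁻ _ gs hit)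
    ...   | g , g∈ , gj∈S = subst (Reach gs i) (All.lookup inv g∈ j) (step (reached (g j) gj∈S) g∈)

    orbit-sound : ∀ {gs i j} → All Involution gs → T (lookup (orbit gs i) j) → Reach gs i j
    orbit-sound {gs} {i} {j} inv =
      iterate-preserves (Reached gs i) (λ {S} → closeStep-reached {gs} {i} {S} inv) n singleton j
      where
      singleton : Reached gs i ⁅ i ⁆
      singleton j j∈ rewrite x∈⁅y⁆⇒x≡y i (T⇒∈ j∈) = start

    -- completeness: the orbit approximation stabilises within n steps at a closed set
    Closed : List (Fin n → Fin n) → Subset n → Set
    Closed gs S = ∀ j → T (lookup (closeStep gs S) j) → T (lookup S j)

    closed-reach : ∀ {gs S i j} → All Involution gs → Closed gs S →
                   T (lookup S i) → Reach gs i j → T (lookup S j)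
    closed-reach inv closed i∈S start = i∈S
    closed-reach {gs} {S = S} inv closed i∈S (step {j = j} {g} p g∈) = closed (g j) (closeStep-adds {gs} S g∈ ggj∈S)
      where
      ggj∈S : T (lookup S (g (g j)))
      ggj∈S = subst (T ∘ lookup S) (sym (All.lookup inv g∈ j)) (closed-reach {S = S} inv closed i∈S p)

    closed-fixed : ∀ gs (S : Subset n) → Closed gs S → closeStep gs S ≡ S
    closed-fixed gs S closed = trans (tabulate-cong unchanged) (tabulate∘lookup S)
      where
      unchanged : ∀ j → (lookup S j ∨ any (λ g → lookup S (g j)) gs) ≡ lookup S j
      unchanged j = T-ext (closed j ∘ subst T (sym (closeStep-lookup gs S j))) (from T-∨ ∘ inj₁)

    closeStep-closed : ∀ gs (S : Subset n) → Closed gs S → Closed gs (closeStep gs S)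
    closeStep-closed gs S closed = subst (Closed gs) (sym (closed-fixed gs S closed)) closed

    closed-or-grows : ∀ gs (S : Subset n) → Closed gs S ⊎ S ⊂ closeStep gs S
    closed-or-grows gs S with any? (λ j → T? (lookup (closeStep gs S) j) ×-dec ¬? (T? (lookup S j)))
    ... | yes (j , j∈ , j∉) =
      inj₂ ((λ x∈ → T⇒∈ (closeStep-inflationary {gs} S (∈⇒T x∈))) , j , T⇒∈ j∈ , j∉ ∘ ∈⇒T)
    ... | no  none          = inj₁ λ j j∈ → decide j j∈
      where
      decide : ∀ j → T (lookup (closeStep gs S) j) → T (lookup S j)
      decide j j∈ with T? (lookup S j)
      ... | yes j∈S = j∈S
      ... | no  j∉S = ⊥-elim (none (j , j∈ , j∉S))

    approx : List (Fin n → Fin n) → Fin n → ℕ → Subset n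
    approx gs i k = iterate k (closeStep gs) ⁅ i ⁆

    closed-or-large : ∀ gs i k → Closed gs (approx gs i k) ⊎ k < ∣ approx gs i k ∣
    closed-or-large gs i zero = inj₂ (subst (0 <_) (sym (∣⁅x⁆∣≡1 i)) (s≤s z≤n))
    closed-or-large gs i (suc k) rewrite iterate-suc k (closeStep gs) ⁅ i ⁆
      with closed-or-large gs i k | closed-or-grows gs (approx gs i k)
    ... | inj₁ closed | _           = inj₁ (closeStep-closed gs (approx gs i k) closed)
    ... | inj₂ _      | inj₁ closed = inj₁ (closeStep-closed gs (approx gs i k) closed)
    ... | inj₂ large  | inj₂ grows  = inj₂ (<-≤-trans (s≤s large) (p⊂q⇒∣p∣<∣q∣ grows))

    orbit-closed : ∀ gs i → Closed gs (orbit gs i)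
    orbit-closed gs i with closed-or-large gs i n
    ... | inj₁ closed = closed
    ... | inj₂ large  = ⊥-elim (<-irrefl refl (<-≤-trans large (∣p∣≤n (orbit gs i))))

    orbit-complete : ∀ {gs i j} → All Involution gs → Reach gs i j → T (lookup (orbit gs i) j)
    orbit-complete {gs} {i} inv = closed-reach {S = orbit gs i} inv (orbit-closed gs i) i∈orbit
      where
      i∈orbit : T (lookup (orbit gs i) i)
      i∈orbit = iterate-preserves (λ S → T (lookup S i)) (λ {S} → closeStep-inflationary {gs} S) n
                                  (∈⇒T (x∈⁅x⁆ i))

    Minimal : List (Fin n → Fin n) → Fin n → Set
    Minimal gs i = ∀ j → toℕ j < toℕ i → ¬ Reach gs i j

    isRep-minimal : ∀ {gs i} → All Involution gs → T (isRep gs i) → Minimal gs i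
    isRep-minimal {gs} {i} inv rep j j<i r = T-not rep (any⁺ _ (lose (∈-allFin j) below))
      where
      below : T ((toℕ j <ᵇ toℕ i) ∧ lookup (orbit gs i) j)
      below = from T-∧ (<⇒<ᵇ j<i , orbit-complete inv r)

    isRep-witness : ∀ {gs i} → All Involution gs → ¬ T (isRep gs i) → ∃ λ j → toℕ j < toℕ i × Reach gs i j
    isRep-witness {gs} {i} inv notRep with find (any⁻ _ (allFin n) (¬T-not notRep))
    ... | j , _ , below with to T-∧ below
    ...   | j<i , j∈orbit = j , <ᵇ⇒< _ _ j<i , orbit-sound inv j∈orbit

    minimal-unique : ∀ {gs i i' p} → All Involution gs → Minimal gs i → Minimal gs i' →
                     Reach gs i p → Reach gs i' p → i ≡ i'
    minimal-unique {i = i} {i'} inv min min' r r' with <-cmp (toℕ i) (toℕ i')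
    ... | tri< i<i' _ _ = ⊥-elim (min' i i<i' (reach-trans r' (reach-sym inv r)))
    ... | tri≈ _ i≡i' _ = toℕ-injective i≡i'
    ... | tri> _ _ i'<i = ⊥-elim (min i' i'<i (reach-trans r (reach-sym inv r')))

    reps : List (Fin n → Fin n) → Subset n
    reps gs = tabulate (isRep gs)

    orbits≡∣reps∣ : ∀ gs → orbits gs ≡ ∣ reps gs ∣
    orbits≡∣reps∣ gs = count≡∣tabulate∣ (isRep gs)

    orbits-mono : ∀ {gs hs} → All Involution gs → All Involution hs → Refines gs hs → orbits hs ≤ orbits gs
    orbits-mono {gs} {hs} invg invh r =
      subst₂ _≤_ (sym (orbits≡∣reps∣ hs)) (sym (orbits≡∣reps∣ gs)) (p⊆q⇒∣p∣≤∣q∣ reps⊆)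
      where
      reps⊆ : reps hs ⊆ reps gs
      reps⊆ {i} i∈ with T? (isRep gs i)
      ... | yes rep = ∈-tabulate⁺ rep
      ... | no  notRep with isRep-witness invg notRep
      ...   | j , j<i , r' = ⊥-elim (isRep-minimal invh (∈-tabulate⁻ i∈) j j<i (reach-refine r r'))

    orbits-cong : ∀ {gs hs} → All Involution gs → All Involution hs → Refines gs hs → Refines hs gs →
                  orbits gs ≡ orbits hs
    orbits-cong invg invh r r' = ≤-antisym (orbits-mono invh invg r') (orbits-mono invg invh r)

  transpose-cases : ∀ {n} (a b x : Fin n) →
                    (x ≡ a × transpose a b x ≡ b) ⊎ (x ≡ b × transpose a b x ≡ a) ⊎
                    (x ≢ a × x ≢ b × transpose a b x ≡ x)
  transpose-cases a b x with x ≟ a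
  ... | yes x≡a = inj₁ (x≡a , refl)
  ... | no  x≢a with x ≟ b
  ...   | yes x≡b = inj₂ (inj₁ (x≡b , refl))
  ...   | no  x≢b = inj₂ (inj₂ (x≢a , x≢b , refl))

  transpose-a : ∀ {n} (a b : Fin n) → transpose a b a ≡ b
  transpose-a a b with transpose-cases a b a
  ... | inj₁ (_ , τa≡b)               = τa≡b
  ... | inj₂ (inj₁ (a≡b , τa≡a))      = trans τa≡a a≡b
  ... | inj₂ (inj₂ (a≢a , _ , _))     = ⊥-elim (a≢a refl)

  transpose-b : ∀ {n} (a b : Fin n) → transpose a b b ≡ a
  transpose-b a b with transpose-cases a b b
  ... | inj₁ (b≡a , τb≡b)             = trans τb≡b b≡a
  ... | inj₂ (inj₁ (_ , τb≡a))        = τb≡a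
  ... | inj₂ (inj₂ (_ , b≢b , _))     = ⊥-elim (b≢b refl)

  transpose-involutive : ∀ {n} (a b x : Fin n) → transpose a b (transpose a b x) ≡ x
  transpose-involutive a b x with transpose-cases a b x
  ... | inj₁ (refl , τx≡b)            = trans (cong (transpose a b) τx≡b) (transpose-b a b)
  ... | inj₂ (inj₁ (refl , τx≡a))     = trans (cong (transpose a b) τx≡a) (transpose-a a b)
  ... | inj₂ (inj₂ (_ , _ , τx≡x))    = trans (cong (transpose a b) τx≡x) τx≡x

  module Transposition {n} {gs : List (Fin n → Fin n)} (inv : All Involution gs) (a b : Fin n) where

    hs : List (Fin n → Fin n)
    hs = transpose a b ∷ gs

    hs-inv : All Involution hs
    hs-inv = transpose-involutive a b All.∷ inv

    Crossing : Fin n → Fin n → Set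
    Crossing i j = (Reach gs i a × Reach gs b j) ⊎ (Reach gs i b × Reach gs a j)

    Split : Fin n → Fin n → Set
    Split i j = Reach gs i j ⊎ Crossing i j

    split : ∀ {i j} → Reach hs i j → Split i j
    split start = inj₁ start
    split (step r (there g∈)) with split r
    ... | inj₁ p                 = inj₁ (step p g∈)
    ... | inj₂ (inj₁ (p , q))    = inj₂ (inj₁ (p , step q g∈))
    ... | inj₂ (inj₂ (p , q))    = inj₂ (inj₂ (p , step q g∈))
    split {i} (step {j = j} r (here refl)) with transpose-cases a b j | split r
    ... | inj₁ (refl , τj≡b)         | inj₁ p              = subst (Split i) (sym τj≡b) (inj₂ (inj₁ (p , start)))
    ... | inj₁ (refl , τj≡b)         | inj₂ (inj₁ (p , _)) = subst (Split i) (sym τj≡b) (inj₂ (inj₁ (p , start)))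
    ... | inj₁ (refl , τj≡b)         | inj₂ (inj₂ (p , _)) = subst (Split i) (sym τj≡b) (inj₁ p)
    ... | inj₂ (inj₁ (refl , τj≡a))  | inj₁ p              = subst (Split i) (sym τj≡a) (inj₂ (inj₂ (p , start)))
    ... | inj₂ (inj₁ (refl , τj≡a))  | inj₂ (inj₁ (p , _)) = subst (Split i) (sym τj≡a) (inj₁ p)
    ... | inj₂ (inj₁ (refl , τj≡a))  | inj₂ (inj₂ (p , _)) = subst (Split i) (sym τj≡a) (inj₂ (inj₂ (p , start)))
    ... | inj₂ (inj₂ (_ , _ , τj≡j)) | s                   = subst (Split i) (sym τj≡j) s

    Below : Fin n → Set
    Below i = ∃ λ j → toℕ j < toℕ i × Crossing i j

    lost : ∀ {i} → T (isRep gs i) → ¬ T (isRep hs i) → Below i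
    lost rep notRep with isRep-witness hs-inv notRep
    ... | j , j<i , r with split r
    ...   | inj₁ p = ⊥-elim (isRep-minimal inv rep j j<i p)
    ...   | inj₂ c = j , j<i , c

    no-opposite-crossings : ∀ {i i' j j'} → Minimal gs i → Minimal gs i' →
                            Reach gs i a → Reach gs b j → toℕ j < toℕ i →
                            Reach gs i' b → Reach gs a j' → toℕ j' < toℕ i' → ⊥
    no-opposite-crossings {i} {i'} {j} {j'} min min' ia bj j<i i'b aj' j'<i' =
      <-irrefl refl (<-≤-trans j<i (≤-trans i≤j' (<⇒≤ (<-≤-trans j'<i' i'≤j))))
      where
      i≤j' : toℕ i ≤ toℕ j'
      i≤j' = ≮⇒≥ λ j'<i → min j' j'<i (reach-trans ia aj')
      i'≤j : toℕ i' ≤ toℕ j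
      i'≤j = ≮⇒≥ λ j<i' → min' j j<i' (reach-trans i'b bj)

    crossings-agree : ∀ {i i'} → Minimal gs i → Minimal gs i' → Below i → Below i' → i ≡ i'
    crossings-agree min min' (_ , _ , inj₁ (ia , _)) (_ , _ , inj₁ (i'a , _)) =
      minimal-unique inv min min' ia i'a
    crossings-agree min min' (_ , _ , inj₂ (ib , _)) (_ , _ , inj₂ (i'b , _)) =
      minimal-unique inv min min' ib i'b
    crossings-agree min min' (_ , j<i , inj₁ (ia , bj)) (_ , j'<i' , inj₂ (i'b , aj')) =
      ⊥-elim (no-opposite-crossings min min' ia bj j<i i'b aj' j'<i')
    crossings-agree min min' (_ , j<i , inj₂ (ib , aj)) (_ , j'<i' , inj₁ (i'a , bj')) =
      ⊥-elim (no-opposite-crossings min' min i'a bj' j'<i' ib aj j<i)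

    lost-unique : ExceptionalUnique (reps gs) (reps hs)
    lost-unique i∈ i∉ i'∈ i'∉ =
      crossings-agree (isRep-minimal inv (∈-tabulate⁻ i∈)) (isRep-minimal inv (∈-tabulate⁻ i'∈))
                      (lost (∈-tabulate⁻ i∈) (i∉ ∘ ∈-tabulate⁺)) (lost (∈-tabulate⁻ i'∈) (i'∉ ∘ ∈-tabulate⁺))

    orbits-transpose : orbits gs ≤ suc (orbits hs)
    orbits-transpose = subst₂ (λ p q → p ≤ suc q) (sym (orbits≡∣reps∣ gs)) (sym (orbits≡∣reps∣ hs))
                              (∣p∣≤1+∣q∣ (reps gs) (reps hs) lost-unique)

  #0 : ∀ {A : Set} {a : A} {l} → a ∈ₗ a ∷ l
  #0 = here refl

  #1 : ∀ {A : Set} {a b : A} {l} → b ∈ₗ a ∷ b ∷ l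
  #1 = there (here refl)

  #2 : ∀ {A : Set} {a b c : A} {l} → c ∈ₗ a ∷ b ∷ c ∷ l
  #2 = there (there (here refl))

  #3 : ∀ {A : Set} {a b c d : A} {l} → d ∈ₗ a ∷ b ∷ c ∷ d ∷ l
  #3 = there (there (there (here refl)))

  gen : ∀ {n} {hs : List (Fin n → Fin n)} {g} → g ∈ₗ hs → ∀ x → Reach hs x (g x)
  gen g∈ x = move g∈ refl

module Components (G : Gem) where
  open Subsets
  open Orbits
  open import Data.Bool using (true; false; not)
  open import Data.Empty using (⊥-elim)
  open import Data.Fin using (Fin)
  open import Data.Fin.Subset using (_∈_; _∉_; _⊆_; _∪_; ∁; ⁅_⁆; ∣_∣; ⊤)
  open import Data.Fin.Subset.Properties using (∣p∣≤n; ∣⊤∣≡n; p⊆q⇒∣p∣≤∣q∣; x∈⁅y⁆⇒x≡y; x∈⁅x⁆; x∈p∪q⁺; x∈p∪q⁻; _∈?_)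
  open import Data.List using (List; []; _∷_; length)
  open import Data.List.Membership.Propositional using () renaming (_∈_ to _∈ₗ_)
  open import Data.List.Relation.Unary.All using (All; []; _∷_)
  open import Data.List.Relation.Unary.Any using (here; there)
  open import Data.Nat using (suc; _+_; _≤_; s≤s)
  open import Data.Nat.Properties using (≤-trans; ≤-reflexive; ≤-antisym; +-monoˡ-≤; +-suc; +-identityʳ)
  open import Data.Product using (proj₁; proj₂)
  open import Data.Sum using (_⊎_; inj₁; inj₂; map₂)
  open import Data.Vec using (lookup)
  open import Data.Vec.Properties using (lookup-map; []=⇒lookup; lookup⇒[]=)
  open import Relation.Binary.PropositionalEquality using (_≡_; refl; sym; trans; cong; subst)
  open import Relation.Nullary using (yes; no)
  open Gem G

  ∈-allE : ∀ {e} → e ∈ allE G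
  ∈-allE = ∈-tabulate⁺ _

  ∣allE∣ : ∣ allE G ∣ ≡ m
  ∣allE∣ = ≤-antisym (∣p∣≤n (allE G))
                     (subst (_≤ ∣ allE G ∣) (∣⊤∣≡n _) (p⊆q⇒∣p∣≤∣q∣ {p = ⊤} λ _ → ∈-allE))

  t0F-in : ∀ {F x} → ed x ∈ F → t0F G F x ≡ t0 x
  t0F-in e∈F rewrite []=⇒lookup e∈F = refl

  t0F-out : ∀ {F x} → ed x ∉ F → t0F G F x ≡ x
  t0F-out {F} {x} e∉F with lookup F (ed x) in eq
  ... | true  = ⊥-elim (e∉F (lookup⇒[]= _ _ eq))
  ... | false = refl

  t0F-involution : ∀ F → Involution (t0F G F)
  t0F-involution F x with ed x ∈? F
  ... | yes e∈F rewrite t0F-in {F} e∈F = trans (t0F-in (subst (_∈ F) (sym (ed-t0 x)) e∈F)) (t0-inv x)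
  ... | no  e∉F rewrite t0F-out {F} e∉F = t0F-out e∉F

  Comp : EdgeSet G → List (Fin n → Fin n)
  Comp F = t1 ∷ t2 ∷ t0F G F ∷ []

  comp-inv : ∀ F → All Involution (Comp F)
  comp-inv F = t1-inv ∷ t2-inv ∷ t0F-involution F ∷ []

  t0F-reach : ∀ {K hs} → (∀ x → ed x ∈ K → Reach hs x (t0 x)) → ∀ x → Reach hs x (t0F G K x)
  t0F-reach {K} h x with ed x ∈? K
  ... | yes e∈K rewrite t0F-in {K} e∈K = h x e∈K
  ... | no  e∉K rewrite t0F-out {K} e∉K = start

  lift-iso : ∀ {a b} → a ≤ b → a + iso ≤ b + iso
  lift-iso = +-monoˡ-≤ iso

  cc-antitone : ∀ F K → F ⊆ K → cc G K ≤ cc G F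
  cc-antitone F K F⊆K = lift-iso (orbits-mono (comp-inv F) (comp-inv K)
    (gen #0 ∷ gen #1 ∷ t0F-reach (λ x e∈F → move #2 (t0F-in (F⊆K e∈F))) ∷ []))

  cc≤v : ∀ F → cc G F ≤ v G
  cc≤v F = lift-iso (orbits-mono (t1-inv ∷ t2-inv ∷ []) (comp-inv F) (gen #0 ∷ gen #1 ∷ []))

  cc-empty : ∀ F → (∀ {e} → e ∉ F) → cc G F ≡ v G
  cc-empty F none = cong (_+ iso)
    (orbits-cong (comp-inv F) (t1-inv ∷ t2-inv ∷ [])
      (gen #0 ∷ gen #1 ∷ t0F-reach (λ x e∈F → ⊥-elim (none e∈F)) ∷ [])
      (gen #0 ∷ gen #1 ∷ []))

  cc-all : cc G (allE G) ≡ cSurf G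
  cc-all = cong (_+ iso)
    (orbits-cong (comp-inv (allE G)) (t0-inv ∷ t1-inv ∷ t2-inv ∷ [])
      (gen #1 ∷ gen #2 ∷ t0F-reach {allE G} (λ x _ → gen #0 x) ∷ [])
      ((λ x → move #2 (t0F-in ∈-allE)) ∷ gen #0 ∷ gen #1 ∷ []))

  -- adding one edge merges at most two components: on the four flags of the new edge,
  -- t0 is generated by t2 and the transposition of one flag x₀ with its t0-image
  module _ (F : EdgeSet G) (e : Fin m) where
    private
      x₀ : Fin n
      x₀ = proj₁ (ed-surj e)

    open Transposition (comp-inv F) x₀ (t0 x₀)

    flag-t0 : ∀ x → ed x ≡ e → Reach hs x (t0 x)
    flag-t0 x ex with ed-fib x₀ x (trans (proj₂ (ed-surj e)) (sym ex))
    ... | inj₁ refl = move #0 (transpose-a x₀ (t0 x₀))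
    ... | inj₂ (inj₁ refl) = move #0 (trans (transpose-b x₀ (t0 x₀)) (sym (t0-inv x₀)))
    ... | inj₂ (inj₂ (inj₁ refl)) =
      reach-trans (move #2 (t2-inv x₀))
        (reach-trans (move #0 (transpose-a x₀ (t0 x₀))) (move #2 (sym (t02-comm x₀))))
    ... | inj₂ (inj₂ (inj₂ refl)) =
      reach-trans (move #2 (trans (sym (t02-comm (t2 x₀))) (cong t0 (t2-inv x₀))))
        (reach-trans (move #0 (transpose-b x₀ (t0 x₀))) (move #2 (sym (t0-inv (t2 x₀)))))

    cc-add-edge : cc G F ≤ suc (cc G (F ∪ ⁅ e ⁆))
    cc-add-edge = lift-iso (≤-trans orbits-transpose (s≤s (orbits-mono (comp-inv (F ∪ ⁅ e ⁆)) hs-inv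
      (gen #1 ∷ gen #2 ∷ t0F-reach new-t0 ∷ []))))
      where
      new-t0 : ∀ x → ed x ∈ F ∪ ⁅ e ⁆ → Reach hs x (t0 x)
      new-t0 x e∈ with x∈p∪q⁻ F ⁅ e ⁆ e∈
      ... | inj₁ e∈F = move #3 (t0F-in e∈F)
      ... | inj₂ e∈e = flag-t0 x (x∈⁅y⁆⇒x≡y e e∈e)

  cc-add-edges : ∀ {H K} es → (∀ {e} → e ∈ K → e ∈ H ⊎ e ∈ₗ es) → cc G H ≤ cc G K + length es
  cc-add-edges {H} {K} [] K⊆H = ≤-trans (cc-antitone K H K⊆H') (≤-reflexive (sym (+-identityʳ _)))
    where
    K⊆H' : K ⊆ H
    K⊆H' e∈K with K⊆H e∈K
    ... | inj₁ e∈H = e∈H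
    ... | inj₂ ()
  cc-add-edges {H} {K} (e ∷ es) K⊆H∪es =
    ≤-trans (cc-add-edge H e) (≤-trans (s≤s (cc-add-edges es K⊆H∪e∪es)) (≤-reflexive (sym (+-suc _ _))))
    where
    K⊆H∪e∪es : ∀ {e'} → e' ∈ K → e' ∈ H ∪ ⁅ e ⁆ ⊎ e' ∈ₗ es
    K⊆H∪e∪es e'∈K with K⊆H∪es e'∈K
    ... | inj₁ e'∈H          = inj₁ (x∈p∪q⁺ (inj₁ e'∈H))
    ... | inj₂ (here refl)   = inj₁ (x∈p∪q⁺ (inj₂ (x∈⁅x⁆ e)))
    ... | inj₂ (there e'∈es) = inj₂ e'∈es

  cc-union : ∀ H F K → K ⊆ H ∪ F → cc G H ≤ cc G K + ∣ F ∣
  cc-union H F K K⊆H∪F = subst (λ k → cc G H ≤ _ + k) (length-elements F)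
    (cc-add-edges (elements F) λ e∈K → map₂ ∈-elements (x∈p∪q⁻ H F (K⊆H∪F e∈K)))

  ρ-involution : ∀ F → Involution (ρ G F)
  ρ-involution F x with lookup F (ed x) in eq
  ... | true  rewrite ed-t0 x | eq = t0-inv x
  ... | false rewrite ed-t2 x | eq = t2-inv x

  v-dual : v (dual G) ≡ faces G
  v-dual = cong (_+ iso) (orbits-cong (t1-inv ∷ t0-inv ∷ []) (t0-inv ∷ t1-inv ∷ [])
                                      (gen #1 ∷ gen #0 ∷ []) (gen #1 ∷ gen #0 ∷ []))

  cSurf-dual : cSurf (dual G) ≡ cSurf G
  cSurf-dual = cong (_+ iso)
    (orbits-cong (t2-inv ∷ t1-inv ∷ t0-inv ∷ []) (t0-inv ∷ t1-inv ∷ t2-inv ∷ [])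
                 (gen #2 ∷ gen #1 ∷ gen #0 ∷ []) (gen #2 ∷ gen #1 ∷ gen #0 ∷ []))

  ρ-dual : ∀ F x → ρ (dual G) (∁ F) x ≡ ρ G F x
  ρ-dual F x rewrite lookup-map (ed x) not F with lookup F (ed x)
  ... | true  = refl
  ... | false = refl

  bdry-dual : ∀ F → bdry (dual G) (∁ F) ≡ bdry G F
  bdry-dual F = cong (_+ iso)
    (orbits-cong (t1-inv ∷ ρ-involution-dual ∷ []) (t1-inv ∷ ρ-involution F ∷ [])
                 (gen #0 ∷ (λ x → move #1 (sym (ρ-dual F x))) ∷ [])
                 (gen #0 ∷ (λ x → move #1 (ρ-dual F x)) ∷ []))
    where
    ρ-involution-dual : Involution (ρ (dual G) (∁ F))
    ρ-involution-dual x =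
      trans (cong (ρ (dual G) (∁ F)) (ρ-dual F x)) (trans (ρ-dual F (ρ G F x)) (ρ-involution F x))

module Arithmetic where
  open import Data.Nat as ℕ using (ℕ; suc; _+_; _∸_; _≤_)
  open import Data.Nat.Properties as ℕ using (m≤n⇒∃[o]m+o≡n; m+n∸m≡n)
  open import Data.Integer as ℤ using (ℤ; +_; -[1+_]; _⊖_)
  open import Data.Integer.Properties using (m-n≡m⊖n; ⊖-≥; pos-+)
  open import Data.Integer.Tactic.RingSolver using (solve-∀)
  open import Data.Product using (∃₂; _,_)
  open import Algebra.Properties.CommutativeSemigroup ℕ.+-commutativeSemigroup
    using () renaming (xy∙z≈xz∙y to +-right-comm; interchange to +-interchange)
  open import Relation.Binary.PropositionalEquality

  -- the bookkeeping of the exponent of Z, with all counts as integers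
  exponent-identityℤ : ∀ (v n₁ n₂ cS cF cC f bd : ℤ) →
    let a = n₂ ℤ.- (f ℤ.- cC) ; b = cF ℤ.- cS in
    (a ℤ.- b) ℤ.+ (a ℤ.- b) ≡
    ((+ 2 ℤ.* cS ℤ.- ((v ℤ.- (n₁ ℤ.+ n₂)) ℤ.+ f)) ℤ.+ ℤ.- (+ 2 ℤ.* cF ℤ.- ((v ℤ.- n₁) ℤ.+ bd)))
      ℤ.+ (+ 2 ℤ.* cC ℤ.- ((f ℤ.- n₂) ℤ.+ bd))
  exponent-identityℤ = solve-∀

  ∸-ℤ : ∀ {m n} → n ≤ m → + (m ∸ n) ≡ + m ℤ.- + n
  ∸-ℤ {m} {n} n≤m = trans (sym (⊖-≥ n≤m)) (sym (m-n≡m⊖n m n))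

  ∸-exact : ∀ n {m k} → n ℕ.+ k ≡ m → m ∸ n ≡ k
  ∸-exact n {k = k} refl = ℕ.m+n∸m≡n n k

  -- the drop of a rank function v ∸ c between nested edge sets
  rank-drop : ∀ {a b c} → a ≤ b → b ≤ c → (c ∸ a) ∸ (c ∸ b) ≡ b ∸ a
  rank-drop {a} a≤b b≤c with m≤n⇒∃[o]m+o≡n a≤b
  ... | p , refl with m≤n⇒∃[o]m+o≡n b≤c
  ... | q , refl = begin
    (a + p + q ∸ a) ∸ (a + p + q ∸ (a + p))
      ≡⟨ cong₂ _∸_ (∸-exact a (sym (ℕ.+-assoc a p q))) (m+n∸m≡n (a + p) q) ⟩
    (p + q) ∸ q
      ≡⟨ ℕ.m+n∸n≡m p q ⟩
    p
      ≡⟨ m+n∸m≡n a p ⟨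
    a + p ∸ a ∎
    where open ≡-Reasoning

  -- the rank |F| + r*(E∖F) − r*(E) of the bond matroid, where r* = f ∸ c* is the rank
  -- of the dual: it equals |F| − (c*(E∖F) − c*(E))
  bond-rank : ∀ {c₀ c f k} → c₀ ≤ c → c ≤ f → c ≤ c₀ + k → (k + (f ∸ c)) ∸ (f ∸ c₀) ≡ k ∸ (c ∸ c₀)
  bond-rank {c₀} c₀≤c c≤f c≤c₀+k with m≤n⇒∃[o]m+o≡n c₀≤c
  ... | p , refl with m≤n⇒∃[o]m+o≡n c≤f | m≤n⇒∃[o]m+o≡n (ℕ.+-cancelˡ-≤ c₀ p _ c≤c₀+k)
  ... | q , refl | t , refl = begin
    (p + t + (c₀ + p + q ∸ (c₀ + p))) ∸ (c₀ + p + q ∸ c₀)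
      ≡⟨ cong₂ (λ x y → (p + t + x) ∸ y) (m+n∸m≡n (c₀ + p) q) (∸-exact c₀ (sym (ℕ.+-assoc c₀ p q))) ⟩
    (p + t + q) ∸ (p + q)
      ≡⟨ ∸-exact (p + q) (+-right-comm p q t) ⟩
    t
      ≡⟨ m+n∸m≡n p t ⟨
    (p + t) ∸ p
      ≡⟨ cong ((p + t) ∸_) (m+n∸m≡n c₀ p) ⟨
    (p + t) ∸ (c₀ + p ∸ c₀) ∎
    where open ≡-Reasoning

  -- the drop of the bond-matroid rank from E (size k₁ + k₂, dual count c₂ of its
  -- complement) to F (size k₁, dual count c₁ of its complement)
  bond-rank-drop : ∀ {c₀ c₁ c₂ k₁ k₂} → c₀ ≤ c₁ → c₁ ≤ c₂ → c₁ ≤ c₀ + k₁ → c₂ ≤ c₁ + k₂ →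
                   ((k₁ + k₂) ∸ (c₂ ∸ c₀)) ∸ (k₁ ∸ (c₁ ∸ c₀)) ≡ k₂ ∸ (c₂ ∸ c₁)
  bond-rank-drop {c₀} c₀≤c₁ c₁≤c₂ c₁≤c₀+k₁ c₂≤c₁+k₂ with m≤n⇒∃[o]m+o≡n c₀≤c₁
  ... | p , refl with m≤n⇒∃[o]m+o≡n c₁≤c₂
  ... | q , refl with m≤n⇒∃[o]m+o≡n (ℕ.+-cancelˡ-≤ c₀ p _ c₁≤c₀+k₁)
                    | m≤n⇒∃[o]m+o≡n (ℕ.+-cancelˡ-≤ (c₀ + p) q _ c₂≤c₁+k₂)
  ... | t , refl | u , refl = begin
    ((p + t + (q + u)) ∸ (c₀ + p + q ∸ c₀)) ∸ ((p + t) ∸ (c₀ + p ∸ c₀))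
      ≡⟨ cong₂ (λ x y → (p + t + (q + u) ∸ x) ∸ ((p + t) ∸ y)) (∸-exact c₀ (sym (ℕ.+-assoc c₀ p q))) (m+n∸m≡n c₀ p) ⟩
    ((p + t + (q + u)) ∸ (p + q)) ∸ ((p + t) ∸ p)
      ≡⟨ cong₂ _∸_ (∸-exact (p + q) (+-interchange p q t u)) (m+n∸m≡n p t) ⟩
    (t + u) ∸ t
      ≡⟨ m+n∸m≡n t u ⟩
    u
      ≡⟨ m+n∸m≡n q u ⟨
    (q + u) ∸ q
      ≡⟨ cong ((q + u) ∸_) (m+n∸m≡n (c₀ + p) q) ⟨
    (q + u) ∸ (c₀ + p + q ∸ (c₀ + p)) ∎
    where open ≡-Reasoning

  as-difference : ∀ i → ∃₂ λ p q → i ≡ p ⊖ q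
  as-difference (+ p)    = p , 0 , refl
  as-difference -[1+ q ] = 0 , suc q , refl

  ⊖-+ : ∀ p q p' q' → (p ⊖ q) ℤ.+ (p' ⊖ q') ≡ (p + p') ⊖ (q + q')
  ⊖-+ p q p' q' = begin
    (p ⊖ q) ℤ.+ (p' ⊖ q')              ≡⟨ cong₂ ℤ._+_ (m-n≡m⊖n p q) (m-n≡m⊖n p' q') ⟨
    (+ p ℤ.- + q) ℤ.+ (+ p' ℤ.- + q')  ≡⟨ regroup (+ p) (+ q) (+ p') (+ q') ⟩
    (+ p ℤ.+ + p') ℤ.- (+ q ℤ.+ + q')  ≡⟨ cong₂ ℤ._-_ (pos-+ p p') (pos-+ q q') ⟨
    + (p + p') ℤ.- + (q + q')          ≡⟨ m-n≡m⊖n (p + p') (q + q') ⟩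
    (p + p') ⊖ (q + q')                ∎
    where
    open ≡-Reasoning
    regroup : ∀ a b c d → (a ℤ.- b) ℤ.+ (c ℤ.- d) ≡ (a ℤ.+ c) ℤ.- (b ℤ.+ d)
    regroup = solve-∀

-- The exponents of the two polynomials agree term by term.  On the dual side
-- write c₀ = c*(E), c = c*(E∖F) and c∅ = c*(∅) for component counts of G*.
module Exponents (G : Gem) (F : EdgeSet G) where
  open Subsets
  open Arithmetic
  open import Data.Empty using (⊥-elim)
  open import Data.Fin.Subset using (∁; ∣_∣)
  open import Data.Fin.Subset.Properties using (q⊆p∪q; x∈∁p⇒x∉p)
  open import Data.Nat as ℕ using (ℕ; _+_; _∸_; _≤_)
  open import Data.Nat.Properties using (m≤n+o⇒m∸n≤o; m∸[m∸n]≡n)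
  open import Data.Integer as ℤ using (ℤ; +_)
  open import Data.Integer.Properties using (pos-+; pos-*)
  open import Relation.Binary.PropositionalEquality
  private
    D = dual G
    E = allE G
    module C  = Components G
    module C* = Components D
    c₀ c c∅ : ℕ
    c₀ = cc D E
    c  = cc D (∁ F)
    c∅ = cc D (∁ E)

    c₀≤c : c₀ ≤ c
    c₀≤c = C*.cc-antitone (∁ F) E (λ _ → C*.∈-allE)
    c≤c∅ : c ≤ c∅
    c≤c∅ = C*.cc-antitone (∁ E) (∁ F) (λ e∈∁E → ⊥-elim (x∈∁p⇒x∉p e∈∁E C.∈-allE))
    c≤c₀+|F| : c ≤ c₀ + ∣ F ∣
    c≤c₀+|F| = C*.cc-union (∁ F) F E (⊆-∁∪ F)
    c∅≤c+|∁F| : c∅ ≤ c + ∣ ∁ F ∣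
    c∅≤c+|∁F| = C*.cc-union (∁ E) (∁ F) (∁ F) (q⊆p∪q (∁ E) (∁ F))
    c∅≡faces : c∅ ≡ faces G
    c∅≡faces = trans (C*.cc-empty (∁ E) λ e∈∁E → x∈∁p⇒x∉p e∈∁E C.∈-allE) C.v-dual
    c₀≡cSurf : c₀ ≡ cSurf G
    c₀≡cSurf = trans C*.cc-all C.cSurf-dual

    rkBar-F : rkBar G F ≡ ∣ F ∣ ∸ (c ∸ c₀)
    rkBar-F = bond-rank c₀≤c (C*.cc≤v (∁ F)) c≤c₀+|F|

    rkBar-E : rkBar G E ≡ (∣ F ∣ + ∣ ∁ F ∣) ∸ (c∅ ∸ c₀)
    rkBar-E = trans (bond-rank (C*.cc-antitone (∁ E) E (λ _ → C*.∈-allE)) (C*.cc≤v (∁ E))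
                               (C*.cc-union (∁ E) E E (⊆-∁∪ E)))
                    (cong (_∸ (c∅ ∸ c₀)) (trans C.∣allE∣ (sym (∣p∣+∣∁p∣≡n F))))

  x-exponent : rk G E ∸ rk G F ≡ cc G F ∸ cc G E
  x-exponent = rank-drop (C.cc-antitone F E λ _ → C.∈-allE) (C.cc≤v F)

  y-exponent : nBar G F ≡ cCompl G F ∸ cSurf G
  y-exponent = begin
    ∣ F ∣ ∸ rkBar G F             ≡⟨ cong (∣ F ∣ ∸_) rkBar-F ⟩
    ∣ F ∣ ∸ (∣ F ∣ ∸ (c ∸ c₀))     ≡⟨ m∸[m∸n]≡n (m≤n+o⇒m∸n≤o c c₀ c≤c₀+|F|) ⟩
    c ∸ c₀                        ≡⟨ cong (c ∸_) c₀≡cSurf ⟩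
    cCompl G F ∸ cSurf G          ∎
    where open ≡-Reasoning

  private
    n₁ n₂ : ℕ
    n₁ = ∣ F ∣
    n₂ = ∣ ∁ F ∣

    bond-rank-dropℤ : + (rkBar G E ∸ rkBar G F) ≡ + n₂ ℤ.- (+ faces G ℤ.- + c)
    bond-rank-dropℤ = begin
      + (rkBar G E ∸ rkBar G F)                    ≡⟨ cong +_ (cong₂ _∸_ rkBar-E rkBar-F) ⟩
      + ((n₁ + n₂) ∸ (c∅ ∸ c₀) ∸ (n₁ ∸ (c ∸ c₀))) ≡⟨ cong +_ (bond-rank-drop c₀≤c c≤c∅ c≤c₀+|F| c∅≤c+|∁F|) ⟩
      + (n₂ ∸ (c∅ ∸ c))                            ≡⟨ ∸-ℤ (m≤n+o⇒m∸n≤o c∅ c c∅≤c+|∁F|) ⟩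
      + n₂ ℤ.- + (c∅ ∸ c)                          ≡⟨ cong (λ t → + n₂ ℤ.- t) (∸-ℤ c≤c∅) ⟩
      + n₂ ℤ.- (+ c∅ ℤ.- + c)                      ≡⟨ cong (λ t → + n₂ ℤ.- (+ t ℤ.- + c)) c∅≡faces ⟩
      + n₂ ℤ.- (+ faces G ℤ.- + c)                 ∎
      where open ≡-Reasoning

    rank-dropℤ : + (rk G E ∸ rk G F) ≡ + cc G F ℤ.- + cSurf G
    rank-dropℤ = begin
      + (rk G E ∸ rk G F)                          ≡⟨ cong +_ x-exponent ⟩
      + (cc G F ∸ cc G E)                          ≡⟨ ∸-ℤ (C.cc-antitone F E λ _ → C.∈-allE) ⟩
      + cc G F ℤ.- + cc G E                        ≡⟨ cong (λ t → + cc G F ℤ.- + t) C.cc-all ⟩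
      + cc G F ℤ.- + cSurf G                       ∎
      where open ≡-Reasoning

    Δ-expanded : Δ G ≡ + 2 ℤ.* + cSurf G ℤ.- ((+ v G ℤ.- (+ n₁ ℤ.+ + n₂)) ℤ.+ + faces G)
    Δ-expanded = cong₂ (λ t u → t ℤ.- ((+ v G ℤ.- u) ℤ.+ + faces G)) (pos-* 2 (cSurf G))
                       (trans (cong +_ (sym (∣p∣+∣∁p∣≡n F))) (pos-+ n₁ n₂))

    s-expanded : s G F ≡ + 2 ℤ.* + cc G F ℤ.- ((+ v G ℤ.- + n₁) ℤ.+ + bdry G F)
    s-expanded = cong (λ t → t ℤ.- ((+ v G ℤ.- + n₁) ℤ.+ + bdry G F)) (pos-* 2 (cc G F))

    sPerp-expanded : sPerp G F ≡ + 2 ℤ.* + c ℤ.- ((+ faces G ℤ.- + n₂) ℤ.+ + bdry G F)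
    sPerp-expanded = trans (cong (λ t → t ℤ.- ((+ v D ℤ.- + n₂) ℤ.+ + bdry D (∁ F))) (pos-* 2 c))
                           (cong₂ (λ u w → + 2 ℤ.* + c ℤ.- ((+ u ℤ.- + n₂) ℤ.+ + w)) C.v-dual (C.bdry-dual F))

  z-exponent : let k = + (rkBar G E ∸ rkBar G F) ℤ.- + (rk G E ∸ rk G F) in
               k ℤ.+ k ≡ Δ G ℤ.+ ℤ.- s G F ℤ.+ sPerp G F
  z-exponent =
    trans (cong (λ t → t ℤ.+ t) (cong₂ ℤ._-_ bond-rank-dropℤ rank-dropℤ))
      (trans (exponent-identityℤ (+ v G) (+ n₁) (+ n₂) (+ cSurf G) (+ cc G F) (+ c) (+ faces G) (+ bdry G F))
             (sym (cong₂ ℤ._+_ (cong₂ (λ δ σ → δ ℤ.+ ℤ.- σ) Δ-expanded s-expanded) sPerp-expanded)))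

module Evaluation {c ℓ : Level} (R : CommutativeRing c ℓ) where
  open Arithmetic using (as-difference; ⊖-+)
  open import Data.Nat as ℕ using (zero; suc)
  open import Data.Integer as ℤ using (+_; -[1+_]; _⊖_)
  open import Data.Integer.Properties using ([1+m]⊖[1+n]≡m⊖n)
  open import Data.List using ([]; _∷_; foldr)
  open import Data.Product using (_,_)
  import Relation.Binary.PropositionalEquality as ≡
  open ≡ using (_≡_)
  open CommutativeRing R
  open Eval R
  open import Algebra.Properties.CommutativeSemiring.Exp commutativeSemiring using (_^_; ^-homo-*; ^-distrib-*)
  open import Algebra.Properties.CommutativeSemigroup *-commutativeSemigroup using (interchange)
  open import Relation.Binary.Reasoning.Setoid setoid

  pow≡^ : ∀ a k → pow a k ≡ a ^ k
  pow≡^ a zero    = ≡.refl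
  pow≡^ a (suc k) = ≡.cong (a *_) (pow≡^ a k)

  pow-+ : ∀ a p q → pow a (p ℕ.+ q) ≈ pow a p * pow a q
  pow-+ a p q = begin
    pow a (p ℕ.+ q)    ≡⟨ pow≡^ a (p ℕ.+ q) ⟩
    a ^ (p ℕ.+ q)      ≈⟨ ^-homo-* a p q ⟩
    a ^ p * a ^ q      ≡⟨ ≡.cong₂ _*_ (pow≡^ a p) (pow≡^ a q) ⟨
    pow a p * pow a q  ∎

  pow-* : ∀ a b k → pow (a * b) k ≈ pow a k * pow b k
  pow-* a b k = begin
    pow (a * b) k      ≡⟨ pow≡^ (a * b) k ⟩
    (a * b) ^ k        ≈⟨ ^-distrib-* a b k ⟩
    a ^ k * b ^ k      ≡⟨ ≡.cong₂ _*_ (pow≡^ a k) (pow≡^ b k) ⟨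
    pow a k * pow b k  ∎

  zpow-* : ∀ u ui v vi i → zpow (u * v) (ui * vi) i ≈ zpow u ui i * zpow v vi i
  zpow-* u ui v vi (+ k)    = pow-* u v k
  zpow-* u ui v vi -[1+ k ] = pow-* ui vi (suc k)

  zpow-neg : ∀ u ui i → zpow ui u i ≡ zpow u ui (ℤ.- i)
  zpow-neg u ui (+ zero)  = ≡.refl
  zpow-neg u ui (+ suc k) = ≡.refl
  zpow-neg u ui -[1+ k ]  = ≡.refl

  module _ {u ui : Carrier} (inverse : u * ui ≈ 1#) where

    zpow-⊖ : ∀ p q → zpow u ui (p ⊖ q) ≈ pow u p * pow ui q
    zpow-⊖ p       zero    = sym (*-identityʳ _)
    zpow-⊖ zero    (suc q) = sym (*-identityˡ _)
    zpow-⊖ (suc p) (suc q) = begin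
      zpow u ui (suc p ⊖ suc q)         ≡⟨ ≡.cong (zpow u ui) ([1+m]⊖[1+n]≡m⊖n p q) ⟩
      zpow u ui (p ⊖ q)                 ≈⟨ zpow-⊖ p q ⟩
      pow u p * pow ui q                ≈⟨ *-identityˡ _ ⟨
      1# * (pow u p * pow ui q)         ≈⟨ *-congʳ inverse ⟨
      (u * ui) * (pow u p * pow ui q)   ≈⟨ interchange u ui (pow u p) (pow ui q) ⟩
      (u * pow u p) * (ui * pow ui q)   ∎

    zpow-+ : ∀ i j → zpow u ui (i ℤ.+ j) ≈ zpow u ui i * zpow u ui j
    zpow-+ i j with as-difference i | as-difference j
    ... | p , q , ≡.refl | p' , q' , ≡.refl = begin
      zpow u ui ((p ⊖ q) ℤ.+ (p' ⊖ q'))                     ≡⟨ ≡.cong (zpow u ui) (⊖-+ p q p' q') ⟩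
      zpow u ui ((p ℕ.+ p') ⊖ (q ℕ.+ q'))                   ≈⟨ zpow-⊖ (p ℕ.+ p') (q ℕ.+ q') ⟩
      pow u (p ℕ.+ p') * pow ui (q ℕ.+ q')                  ≈⟨ *-cong (pow-+ u p p') (pow-+ ui q q') ⟩
      (pow u p * pow u p') * (pow ui q * pow ui q')         ≈⟨ interchange (pow u p) (pow u p') (pow ui q) (pow ui q') ⟩
      (pow u p * pow ui q) * (pow u p' * pow ui q')         ≈⟨ *-cong (zpow-⊖ p q) (zpow-⊖ p' q') ⟨
      zpow u ui (p ⊖ q) * zpow u ui (p' ⊖ q')               ∎

    square-split : ∀ k δ σ σ⊥ → k ℤ.+ k ≡ δ ℤ.+ ℤ.- σ ℤ.+ σ⊥ →
                   zpow (u * u) (ui * ui) k ≈ zpow u ui δ * (zpow ui u σ * zpow u ui σ⊥)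
    square-split k δ σ σ⊥ eq = begin
      zpow (u * u) (ui * ui) k                         ≈⟨ zpow-* u ui u ui k ⟩
      zpow u ui k * zpow u ui k                        ≈⟨ zpow-+ k k ⟨
      zpow u ui (k ℤ.+ k)                              ≡⟨ ≡.cong (zpow u ui) eq ⟩
      zpow u ui (δ ℤ.+ ℤ.- σ ℤ.+ σ⊥)                   ≈⟨ zpow-+ (δ ℤ.+ ℤ.- σ) σ⊥ ⟩
      zpow u ui (δ ℤ.+ ℤ.- σ) * zpow u ui σ⊥           ≈⟨ *-congʳ (zpow-+ δ (ℤ.- σ)) ⟩
      (zpow u ui δ * zpow u ui (ℤ.- σ)) * zpow u ui σ⊥ ≈⟨ *-assoc _ _ _ ⟩
      zpow u ui δ * (zpow u ui (ℤ.- σ) * zpow u ui σ⊥) ≡⟨ ≡.cong (λ t → zpow u ui δ * (t * zpow u ui σ⊥)) (zpow-neg u ui σ) ⟨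
      zpow u ui δ * (zpow ui u σ * zpow u ui σ⊥)       ∎

  sum-scale : ∀ {A : Set} (f g : A → Carrier) (k : Carrier) → (∀ a → f a ≈ k * g a) →
              ∀ xs → foldr (λ a acc → f a + acc) 0# xs ≈ k * foldr (λ a acc → g a + acc) 0# xs
  sum-scale f g k f≈kg []       = sym (zeroʳ k)
  sum-scale f g k f≈kg (a ∷ as) = begin
    f a + foldr _ 0# as            ≈⟨ +-cong (f≈kg a) (sum-scale f g k f≈kg as) ⟩
    k * g a + k * foldr _ 0# as    ≈⟨ distribˡ k (g a) _ ⟨
    k * (g a + foldr _ 0# as)      ∎

module TermByTerm {c ℓ : Level} (R : CommutativeRing c ℓ) (G : Gem) (x y : CommutativeRing.Carrier R)
                  {w winv : CommutativeRing.Carrier R}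
                  (inverse : CommutativeRing._≈_ R (CommutativeRing._*_ R w winv) (CommutativeRing.1# R)) where
  open import Data.Nat using (_∸_)
  open import Data.Integer as ℤ using (+_)
  import Relation.Binary.PropositionalEquality as ≡
  open ≡ using (_≡_)
  open CommutativeRing R
  open Eval R
  open Evaluation R
  open import Algebra.Properties.CommutativeSemigroup *-commutativeSemigroup using (x∙yz≈y∙xz)
  open import Relation.Binary.Reasoning.Setoid setoid

  E : EdgeSet G
  E = allE G

  lvTerm : EdgeSet G → Carrier
  lvTerm F = pow (x - 1#) (rk G E ∸ rk G F) * pow (y - 1#) (nBar G F)
           * zpow (w * w) (winv * winv) (+ (rkBar G E ∸ rkBar G F) ℤ.- + (rk G E ∸ rk G F))

  pTerm : EdgeSet G → Carrier
  pTerm F = pow (x - 1#) (cc G F ∸ cc G E) * pow (y - 1#) (cCompl G F ∸ cSurf G)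
          * zpow winv w (s G F) * zpow w winv (sPerp G F)

  term-identity : ∀ F → lvTerm F ≈ zpow w winv (Δ G) * pTerm F
  term-identity F = begin
    XY * zpow (w * w) (winv * winv) k  ≈⟨ *-cong (reflexive XY≡XY′) Z-split ⟩
    XY′ * (zΔ * AB)                    ≈⟨ x∙yz≈y∙xz XY′ zΔ AB ⟩
    zΔ * (XY′ * AB)                    ≈⟨ *-congˡ (*-assoc XY′ _ _) ⟨
    zΔ * pTerm F                       ∎
    where
    open Exponents G F
    k = + (rkBar G E ∸ rkBar G F) ℤ.- + (rk G E ∸ rk G F)
    zΔ = zpow w winv (Δ G)
    AB = zpow winv w (s G F) * zpow w winv (sPerp G F)
    XY = pow (x - 1#) (rk G E ∸ rk G F) * pow (y - 1#) (nBar G F)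
    XY′ = pow (x - 1#) (cc G F ∸ cc G E) * pow (y - 1#) (cCompl G F ∸ cSurf G)
    XY≡XY′ : XY ≡ XY′
    XY≡XY′ = ≡.cong₂ (λ p q → pow (x - 1#) p * pow (y - 1#) q) x-exponent y-exponent
    Z-split : zpow (w * w) (winv * winv) k ≈ zΔ * AB
    Z-split = square-split inverse k (Δ G) (s G F) (sPerp G F) z-exponent

theorem5p5 : ∀ {c ℓ : Level} (R : CommutativeRing c ℓ) (G : Gem) (x y w winv : CommutativeRing.Carrier R) → CommutativeRing._≈_ R (CommutativeRing._*_ R w winv) (CommutativeRing.1# R) → CommutativeRing._≈_ R (Eval.LV R G x y (CommutativeRing._*_ R w w) (CommutativeRing._*_ R winv winv)) (CommutativeRing._*_ R (Eval.zpow R w winv (Δ G)) (Eval.P½ R G (CommutativeRing._-_ R x (CommutativeRing.1# R)) (CommutativeRing._-_ R y (CommutativeRing.1# R)) winv w w winv))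
theorem5p5 R G x y w winv inverse =
  sum-scale lvTerm pTerm (Eval.zpow R w winv (Δ G)) term-identity (allSubsets (Gem.m G))
  where
  open Evaluation R
  open TermByTerm R G x y inverse
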